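{- Let $G$ be a graph and let $U$ be the set of vertices $u\in V(G)$ such that the connected component of $G$ containing $u$ is a complete graph. Then $\mu_\alpha(G)=\mu_\alpha(G-U)$.
   Context: All graphs are finite and simple; the null graph is allowed, with $\alpha=i=0$. For a graph $G$, $\alpha(G)$ is the maximum size of an independent set, $i(G)$ is the minimum size of an inclusion-maximal independent set, and $\mu_\alpha(G)=\alpha(G)-i(G)$. -}

module Defs where

open import Data.Nat using (ℕ; _≤_)
open import Data.Bool using (Bool; true; false)
open import Data.Fin using (Fin)
open import Data.Fin.Subset using (Subset; _∈_; _∉_; _⊆_; ∣_∣)
open import Data.Product using (Σ; _×_; ∃)
open import Relation.Binary.PropositionalEquality using (_≡_; _≢_)

record Graph (n : ℕ) : Set where
  field
    adj    : Fin n → Fin n → Bool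
    sym    : ∀ x y → adj x y ≡ adj y x
    irrefl : ∀ x → adj x x ≡ false

open Graph public

Adj : ∀ {n} → Graph n → Fin n → Fin n → Set
Adj G x y = adj G x y ≡ true

data Reachable {n} (G : Graph n) : Fin n → Fin n → Set where
  here : ∀ {u} → Reachable G u u
  step : ∀ {u w v} → Adj G u w → Reachable G w v → Reachable G u v

ComponentComplete : ∀ {n} → Graph n → Fin n → Set
ComponentComplete G u =
  ∀ v w → Reachable G u v → Reachable G u w → v ≢ w → Adj G v w

-- Everything below concerns the induced subgraph G[W] for W ⊆ V(G);
-- G itself is G[⊤] and G - U is G[∁ U].

IndependentIn : ∀ {n} → Graph n → Subset n → Subset n → Set
IndependentIn G W S = S ⊆ W × (∀ x y → x ∈ S → y ∈ S → ¬Adj x y)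
  where
  ¬Adj : _ → _ → Set
  ¬Adj x y = adj G x y ≡ false

MaximalIndependentIn : ∀ {n} → Graph n → Subset n → Subset n → Set
MaximalIndependentIn G W S =
  IndependentIn G W S ×
  (∀ v → v ∈ W → v ∉ S → ∃ λ s → s ∈ S × Adj G s v)

IsAlpha : ∀ {n} → Graph n → Subset n → ℕ → Set
IsAlpha G W k =
  (∃ λ S → IndependentIn G W S × ∣ S ∣ ≡ k) ×
  (∀ S → IndependentIn G W S → ∣ S ∣ ≤ k)

IsI : ∀ {n} → Graph n → Subset n → ℕ → Set
IsI G W k =
  (∃ λ S → MaximalIndependentIn G W S × ∣ S ∣ ≡ k) ×
  (∀ S → MaximalIndependentIn G W S → k ≤ ∣ S ∣)

module Submission where

-- The vertices lying in complete components form a union U of components, so the (maximal)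
-- independent sets of G are exactly the unions of those of G[U] and of G - U, and both α and i
-- are additive over this split. In G[U] every maximal independent set takes one vertex from
-- each component, so α(G[U]) = i(G[U]) and this contribution cancels in α(G) - i(G).

open import Defs
open import Data.Nat using (_∸_; suc; _+_; _≤_; z≤n; s≤s)
open import Data.Nat.Properties using (≤-antisym; ≤-reflexive; ≤-trans; +-mono-≤; +-suc; [m+n]∸[m+o]≡n∸o; module ≤-Reasoning)
open import Data.Bool using (false)
open import Data.Bool.Properties using (¬-not)
open import Data.Vec using (_∷_; []; here; there)
open import Data.Fin using (Fin; zero; suc; _≟_)
open import Data.Fin.Subset using (Subset; _∈_; _∉_; _⊆_; _⊂_; ⊤; ∁; ∣_∣; _∩_; _∪_; _-_; inside; outside)
open import Data.Fin.Subset.Properties using (_∈?_; nonempty?; Empty-unique; ∣⊥∣≡0; ∈⊤; x∈p∩q⁺; x∈p∩q⁻; x∈p∪q⁺; x∈p∪q⁻; x∈p⇒x∉∁p; x∈∁p⇒x∉p; x∉p⇒x∈∁p; p─⊥≡p; p─q⊆p; x∈p∧x≢y⇒x∈p-y; x∈p⇒p-x⊂p; x∈p⇒∣p-x∣<∣p∣)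
open import Data.Fin.Subset.Induction using (⊂-wellFounded)
open import Data.Product using (∃; _×_; _,_; proj₁; proj₂)
open import Data.Sum using (_⊎_; inj₁; inj₂)
open import Function using (_∘_)
open import Function.Bundles using (_⇔_; Equivalence)
open import Induction.WellFounded using (Acc; acc)
open import Relation.Nullary using (yes; no; contradiction)
open import Relation.Binary.PropositionalEquality using (_≡_; _≢_; refl; cong; cong₂; trans; module ≡-Reasoning)
  renaming (sym to ≡-sym)

∣p∣≡suc∣p-x∣ : ∀ {n} {p : Subset n} {x} → x ∈ p → ∣ p ∣ ≡ suc ∣ p - x ∣
∣p∣≡suc∣p-x∣ {p = inside  ∷ p} here = cong (suc ∘ ∣_∣) (≡-sym (p─⊥≡p p))
∣p∣≡suc∣p-x∣ {p = inside  ∷ p} (there x∈p) = cong suc (∣p∣≡suc∣p-x∣ x∈p)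
∣p∣≡suc∣p-x∣ {p = outside ∷ p} (there x∈p) = ∣p∣≡suc∣p-x∣ x∈p

x∈p-y⇒x≢y : ∀ {n} {p : Subset n} {x y} → x ∈ p - y → x ≢ y
x∈p-y⇒x≢y {p = _ ∷ _} {zero} () refl
x∈p-y⇒x≢y {p = _ ∷ _} {suc x} (there x∈p-y) refl = x∈p-y⇒x≢y x∈p-y refl

∣p∣≡∣p∩q∣+∣p∩∁q∣ : ∀ {n} (p q : Subset n) → ∣ p ∣ ≡ ∣ p ∩ q ∣ + ∣ p ∩ ∁ q ∣
∣p∣≡∣p∩q∣+∣p∩∁q∣ [] [] = refl
∣p∣≡∣p∩q∣+∣p∩∁q∣ (inside  ∷ p) (inside  ∷ q) = cong suc (∣p∣≡∣p∩q∣+∣p∩∁q∣ p q)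
∣p∣≡∣p∩q∣+∣p∩∁q∣ (inside  ∷ p) (outside ∷ q) = trans (cong suc (∣p∣≡∣p∩q∣+∣p∩∁q∣ p q)) (≡-sym (+-suc _ _))
∣p∣≡∣p∩q∣+∣p∩∁q∣ (outside ∷ p) (inside  ∷ q) = ∣p∣≡∣p∩q∣+∣p∩∁q∣ p q
∣p∣≡∣p∩q∣+∣p∩∁q∣ (outside ∷ p) (outside ∷ q) = ∣p∣≡∣p∩q∣+∣p∩∁q∣ p q

∣p∪q∣≡∣p∣+∣q∣ : ∀ {n} (p q : Subset n) → (∀ {x} → x ∈ p → x ∉ q) → ∣ p ∪ q ∣ ≡ ∣ p ∣ + ∣ q ∣
∣p∪q∣≡∣p∣+∣q∣ [] [] disjoint = refl
∣p∪q∣≡∣p∣+∣q∣ (inside  ∷ p) (inside  ∷ q) disjoint = contradiction here (disjoint here)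
∣p∪q∣≡∣p∣+∣q∣ (inside  ∷ p) (outside ∷ q) disjoint =
  cong suc (∣p∪q∣≡∣p∣+∣q∣ p q λ x∈p x∈q → disjoint (there x∈p) (there x∈q))
∣p∪q∣≡∣p∣+∣q∣ (outside ∷ p) (inside  ∷ q) disjoint =
  trans (cong suc (∣p∪q∣≡∣p∣+∣q∣ p q λ x∈p x∈q → disjoint (there x∈p) (there x∈q))) (≡-sym (+-suc _ _))
∣p∪q∣≡∣p∣+∣q∣ (outside ∷ p) (outside ∷ q) disjoint =
  ∣p∪q∣≡∣p∣+∣q∣ p q λ x∈p x∈q → disjoint (there x∈p) (there x∈q)

⊆-∁-disjoint : ∀ {n} {p q r : Subset n} {x} → p ⊆ r → q ⊆ ∁ r → x ∈ p → x ∉ q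
⊆-∁-disjoint p⊆r q⊆∁r x∈p x∈q = x∈∁p⇒x∉p (q⊆∁r x∈q) (p⊆r x∈p)

-- Remove a matched pair x ∈ p, y ∈ q and recurse; injectivity keeps the rest of p matched into q - y.
matching⇒∣p∣≤∣q∣ : ∀ {n} (R : Fin n → Fin n → Set) {p q : Subset n} →
  (∀ {x} → x ∈ p → ∃ λ y → y ∈ q × R x y) →
  (∀ {x x′ y} → x ∈ p → x′ ∈ p → R x y → R x′ y → x ≡ x′) →
  ∣ p ∣ ≤ ∣ q ∣
matching⇒∣p∣≤∣q∣ {n} R = go (⊂-wellFounded _)
  where
  go : ∀ {p q : Subset n} → Acc _⊂_ p →
    (∀ {x} → x ∈ p → ∃ λ y → y ∈ q × R x y) →
    (∀ {x x′ y} → x ∈ p → x′ ∈ p → R x y → R x′ y → x ≡ x′) →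
    ∣ p ∣ ≤ ∣ q ∣
  go {p} {q} (acc smaller) matched injective with nonempty? p
  ... | no empty = ≤-trans (≤-reflexive (trans (cong ∣_∣ (Empty-unique empty)) (∣⊥∣≡0 n))) z≤n
  ... | yes (x , x∈p) with matched x∈p
  ... | y , y∈q , xRy = begin
    ∣ p ∣          ≡⟨ ∣p∣≡suc∣p-x∣ x∈p ⟩
    suc ∣ p - x ∣  ≤⟨ s≤s (go (smaller (x∈p⇒p-x⊂p x∈p)) matched′ injective′) ⟩
    suc ∣ q - y ∣  ≤⟨ x∈p⇒∣p-x∣<∣p∣ y∈q ⟩
    ∣ q ∣          ∎
    where
    open ≤-Reasoning
    matched′ : ∀ {x′} → x′ ∈ p - x → ∃ λ y′ → y′ ∈ q - y × R x′ y′
    matched′ x′∈p-x with matched (p─q⊆p _ _ x′∈p-x)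
    ... | y′ , y′∈q , x′Ry′ = y′ , x∈p∧x≢y⇒x∈p-y y′∈q y′≢y , x′Ry′
      where
      y′≢y : y′ ≢ y
      y′≢y refl = x∈p-y⇒x≢y x′∈p-x (injective (p─q⊆p _ _ x′∈p-x) x∈p x′Ry′ xRy)
    injective′ : ∀ {x₁ x₂ y′} → x₁ ∈ p - x → x₂ ∈ p - x → R x₁ y′ → R x₂ y′ → x₁ ≡ x₂
    injective′ x₁∈ x₂∈ = injective (p─q⊆p _ _ x₁∈) (p─q⊆p _ _ x₂∈)

Closed : ∀ {n} → Graph n → Subset n → Set
Closed G V = ∀ {x y} → x ∈ V → Adj G x y → y ∈ V

module _ {n} (G : Graph n) where

  Adj-sym : ∀ {x y} → Adj G x y → Adj G y x
  Adj-sym {x} {y} xy = trans (sym G y x) xy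

  Closed-∁ : ∀ {V} → Closed G V → Closed G (∁ V)
  Closed-∁ closed x∈∁V xy = x∉p⇒x∈∁p λ y∈V → x∈∁p⇒x∉p x∈∁V (closed y∈V (Adj-sym xy))

  Closed⇒¬Adj : ∀ {V x y} → Closed G V → x ∈ V → y ∉ V → adj G x y ≡ false
  Closed⇒¬Adj closed x∈V y∉V = ¬-not λ xy → y∉V (closed x∈V xy)

  independent-∩ : ∀ {W V S} → IndependentIn G W S → IndependentIn G V (S ∩ V)
  independent-∩ {V = V} {S = S} (_ , independent) =
    proj₂ ∘ x∈p∩q⁻ S V ,
    λ x y x∈ y∈ → independent x y (proj₁ (x∈p∩q⁻ S V x∈)) (proj₁ (x∈p∩q⁻ S V y∈))

  maximal-∩ : ∀ {V M} → Closed G V → MaximalIndependentIn G ⊤ M → MaximalIndependentIn G V (M ∩ V)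
  maximal-∩ {V} {M} closed (independent , dominating) = independent-∩ independent , dominating′
    where
    dominating′ : ∀ v → v ∈ V → v ∉ M ∩ V → ∃ λ s → s ∈ M ∩ V × Adj G s v
    dominating′ v v∈V v∉M∩V with dominating v ∈⊤ (λ v∈M → v∉M∩V (x∈p∩q⁺ (v∈M , v∈V)))
    ... | s , s∈M , sv = s , x∈p∩q⁺ (s∈M , closed v∈V (Adj-sym sv)) , sv

  independent-∪ : ∀ {V P Q} → Closed G V →
    IndependentIn G V P → IndependentIn G (∁ V) Q → IndependentIn G ⊤ (P ∪ Q)
  independent-∪ {V} {P} {Q} closed (P⊆V , independentP) (Q⊆∁V , independentQ) = (λ _ → ∈⊤) , independent
    where
    independent : ∀ x y → x ∈ P ∪ Q → y ∈ P ∪ Q → adj G x y ≡ false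
    independent x y x∈ y∈ with x∈p∪q⁻ P Q x∈ | x∈p∪q⁻ P Q y∈
    ... | inj₁ x∈P | inj₁ y∈P = independentP x y x∈P y∈P
    ... | inj₂ x∈Q | inj₂ y∈Q = independentQ x y x∈Q y∈Q
    ... | inj₁ x∈P | inj₂ y∈Q = Closed⇒¬Adj closed (P⊆V x∈P) (x∈∁p⇒x∉p (Q⊆∁V y∈Q))
    ... | inj₂ x∈Q | inj₁ y∈P = Closed⇒¬Adj (Closed-∁ closed) (Q⊆∁V x∈Q) (x∈p⇒x∉∁p (P⊆V y∈P))

  maximal-∪ : ∀ {V P Q} → Closed G V →
    MaximalIndependentIn G V P → MaximalIndependentIn G (∁ V) Q → MaximalIndependentIn G ⊤ (P ∪ Q)
  maximal-∪ {V} {P} {Q} closed (independentP , dominatingP) (independentQ , dominatingQ) =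
    independent-∪ closed independentP independentQ , dominating
    where
    dominating : ∀ v → v ∈ ⊤ → v ∉ P ∪ Q → ∃ λ s → s ∈ P ∪ Q × Adj G s v
    dominating v _ v∉P∪Q with v ∈? V
    ... | yes v∈V with dominatingP v v∈V (v∉P∪Q ∘ x∈p∪q⁺ ∘ inj₁)
    ...   | s , s∈P , sv = s , x∈p∪q⁺ (inj₁ s∈P) , sv
    dominating v _ v∉P∪Q | no v∉V with dominatingQ v (x∉p⇒x∈∁p v∉V) (v∉P∪Q ∘ x∈p∪q⁺ ∘ inj₂)
    ...   | s , s∈Q , sv = s , x∈p∪q⁺ (inj₂ s∈Q) , sv

  IsAlpha-∪ : ∀ {V p q a} → Closed G V → IsAlpha G V p → IsAlpha G (∁ V) q → IsAlpha G ⊤ a → a ≡ p + q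
  IsAlpha-∪ {V} closed ((P , independentP , refl) , maximumV) ((Q , independentQ , refl) , maximum∁V)
            ((S , independentS , refl) , maximum) = ≤-antisym upper lower
    where
    open ≤-Reasoning
    upper : ∣ S ∣ ≤ ∣ P ∣ + ∣ Q ∣
    upper = begin
      ∣ S ∣                     ≡⟨ ∣p∣≡∣p∩q∣+∣p∩∁q∣ S V ⟩
      ∣ S ∩ V ∣ + ∣ S ∩ ∁ V ∣   ≤⟨ +-mono-≤ (maximumV _ (independent-∩ independentS))
                                            (maximum∁V _ (independent-∩ independentS)) ⟩
      ∣ P ∣ + ∣ Q ∣             ∎
    lower : ∣ P ∣ + ∣ Q ∣ ≤ ∣ S ∣
    lower = begin
      ∣ P ∣ + ∣ Q ∣  ≡⟨ ∣p∪q∣≡∣p∣+∣q∣ P Q (⊆-∁-disjoint (proj₁ independentP) (proj₁ independentQ)) ⟨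
      ∣ P ∪ Q ∣      ≤⟨ maximum _ (independent-∪ closed independentP independentQ) ⟩
      ∣ S ∣          ∎

  IsI-∪ : ∀ {V p q b} → Closed G V → IsI G V p → IsI G (∁ V) q → IsI G ⊤ b → b ≡ p + q
  IsI-∪ {V} closed ((P , maximalP , refl) , minimumV) ((Q , maximalQ , refl) , minimum∁V)
        ((M , maximalM , refl) , minimum) = ≤-antisym upper lower
    where
    open ≤-Reasoning
    upper : ∣ M ∣ ≤ ∣ P ∣ + ∣ Q ∣
    upper = begin
      ∣ M ∣          ≤⟨ minimum _ (maximal-∪ closed maximalP maximalQ) ⟩
      ∣ P ∪ Q ∣      ≡⟨ ∣p∪q∣≡∣p∣+∣q∣ P Q (⊆-∁-disjoint (proj₁ (proj₁ maximalP)) (proj₁ (proj₁ maximalQ))) ⟩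
      ∣ P ∣ + ∣ Q ∣  ∎
    lower : ∣ P ∣ + ∣ Q ∣ ≤ ∣ M ∣
    lower = begin
      ∣ P ∣ + ∣ Q ∣             ≤⟨ +-mono-≤ (minimumV _ (maximal-∩ closed maximalM))
                                            (minimum∁V _ (maximal-∩ (Closed-∁ closed) maximalM)) ⟩
      ∣ M ∩ V ∣ + ∣ M ∩ ∁ V ∣   ≡⟨ ∣p∣≡∣p∩q∣+∣p∩∁q∣ M V ⟨
      ∣ M ∣                     ∎

  ComponentComplete-step : ∀ {u w} → ComponentComplete G u → Adj G u w → ComponentComplete G w
  ComponentComplete-step complete uw v v′ wv wv′ = complete v v′ (step uw wv) (step uw wv′)

  -- Map each x ∈ I to itself or a neighbour in M; two vertices of I with a common image lie
  -- in one complete component, so they would be adjacent unless equal.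
  independent≤maximal : ∀ {V I M} → (∀ {v} → v ∈ V → ComponentComplete G v) →
    IndependentIn G V I → MaximalIndependentIn G V M → ∣ I ∣ ≤ ∣ M ∣
  independent≤maximal {V} {I} {M} complete (I⊆V , independentI) (_ , dominatingM) =
    matching⇒∣p∣≤∣q∣ SelfOrAdj matched injective
    where
    SelfOrAdj : Fin n → Fin n → Set
    SelfOrAdj x y = x ≡ y ⊎ Adj G x y

    toward : ∀ {x y z} → SelfOrAdj x y → Reachable G y z → Reachable G x z
    toward (inj₁ refl) yz = yz
    toward (inj₂ xy) yz = step xy yz

    back : ∀ {x y} → SelfOrAdj x y → Reachable G y x
    back (inj₁ refl) = here
    back (inj₂ xy) = step (Adj-sym xy) here

    matched : ∀ {x} → x ∈ I → ∃ λ y → y ∈ M × SelfOrAdj x y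
    matched {x} x∈I with x ∈? M
    ... | yes x∈M = x , x∈M , inj₁ refl
    ... | no x∉M with dominatingM x (I⊆V x∈I) x∉M
    ...   | s , s∈M , sx = s , s∈M , inj₂ (Adj-sym sx)

    injective : ∀ {x x′ y} → x ∈ I → x′ ∈ I → SelfOrAdj x y → SelfOrAdj x′ y → x ≡ x′
    injective {x} {x′} x∈I x′∈I xy x′y with x ≟ x′
    ... | yes x≡x′ = x≡x′
    ... | no x≢x′ with trans (≡-sym (independentI x x′ x∈I x′∈I))
                             (complete (I⊆V x∈I) x x′ here (toward xy (back x′y)) x≢x′)
    ...   | ()

  maximal⇒IsAlpha : ∀ {V M} → (∀ {v} → v ∈ V → ComponentComplete G v) →
    MaximalIndependentIn G V M → IsAlpha G V ∣ M ∣
  maximal⇒IsAlpha complete maximalM@(independentM , _) =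
    (_ , independentM , refl) , λ _ independentS → independent≤maximal complete independentS maximalM

  maximal⇒IsI : ∀ {V M} → (∀ {v} → v ∈ V → ComponentComplete G v) →
    MaximalIndependentIn G V M → IsI G V ∣ M ∣
  maximal⇒IsI complete maximalM@(independentM , _) =
    (_ , maximalM , refl) , λ _ maximalS → independent≤maximal complete independentM maximalS

corollary2p3 : ∀ {n} (G : Graph n) (U : Subset n) →
    (∀ u → (u ∈ U) ⇔ ComponentComplete G u) →
    ∀ a b c d →
    IsAlpha G ⊤ a → IsI G ⊤ b → IsAlpha G (∁ U) c → IsI G (∁ U) d →
    a ∸ b ≡ c ∸ d
corollary2p3 G U U⇔complete a b c d α-G i-G α-G-U i-G-U = begin
  a ∸ b                      ≡⟨ cong₂ _∸_ (IsAlpha-∪ G U-closed (maximal⇒IsAlpha G U-complete maximalT) α-G-U α-G)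
                                          (IsI-∪ G U-closed (maximal⇒IsI G U-complete maximalT) i-G-U i-G) ⟩
  (∣ T ∣ + c) ∸ (∣ T ∣ + d)  ≡⟨ [m+n]∸[m+o]≡n∸o ∣ T ∣ c d ⟩
  c ∸ d                      ∎
  where
  open ≡-Reasoning
  U-complete : ∀ {u} → u ∈ U → ComponentComplete G u
  U-complete = Equivalence.to (U⇔complete _)
  U-closed : Closed G U
  U-closed u∈U uw = Equivalence.from (U⇔complete _) (ComponentComplete-step G (U-complete u∈U) uw)
  T : Subset _
  T = proj₁ (proj₁ i-G) ∩ U
  maximalT : MaximalIndependentIn G U T
  maximalT = maximal-∩ G U-closed (proj₁ (proj₂ (proj₁ i-G)))
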